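{- Assume the setting below. Then $(0,\omega)$ is a dualizing object of $\int Q$ if and only if $0$ is a dualizing object of $\mathsf{C}$ and $\jmath_X(\alpha)=\alpha$ for every object $X$ of $\mathsf{C}$ and every $\alpha\in Q(X)$.
   Context: $(\mathsf{C},\otimes,I,a,\lambda,\rho,\sigma)$ is $*$-autonomous: symmetric monoidal closed with internal hom $\multimap$, counit $\mathrm{ev}_{X,Y}:X\otimes(X\multimap Y)\to Y$, and a dualizing object $0$. $Q:\mathsf{C}\to\mathsf{SLatt}$ is a monoidal functor into complete lattices and sup-preserving maps, with $u\in Q(I)$ and maps $\mu_{X,Y}:Q(X)\times Q(Y)\to Q(X\otimes Y)$ that are sup-preserving in each variable, natural, and satisfy $Q(\lambda_Y)(\mu_{I,Y}(u,y))=y$, $Q(\rho_X)(\mu_{X,I}(x,u))=x$, $Q(a)(\mu(\mu(x,y),z))=\mu(x,\mu(y,z))$, $Q(\sigma_{X,Y})(\mu_{X,Y}(x,y))=\mu_{Y,X}(y,x)$. $\int Q$ has objects $(X,x)$, $x\in Q(X)$, and arrows $f:(X,x)\to(Y,y)$ with $Q(f)(x)\le y$; it is symmetric monoidal closed with $(X,x)\otimes(Y,y)=(X\otimes Y,\mu(x,y))$, unit $(I,u)$, and $(X,\alpha)\multimap(Y,\beta)=(X\multimap Y,\iota_{X,Y}(\alpha,\beta))$, where $\langle x,b\rangle_{X,Y}:=Q(\mathrm{ev}_{X,Y})(\mu_{X,X\multimap Y}(x,b))$ and $\iota_{X,Y}(\alpha,-)$ is the right adjoint of $\langle\alpha,-\rangle_{X,Y}$.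 Fix $\omega\in Q(0)$; $X^*:=X\multimap0$, $\langle\alpha,\beta\rangle_X:=\langle\alpha,\beta\rangle_{X,0}$, $\omega_X(\alpha):=\iota_{X,0}(\alpha,\omega)$, $\beta^\perp:=\bigvee\{\alpha\in Q(X)\mid\langle\alpha,\beta\rangle_X\le\omega\}$ for $\beta\in Q(X^*)$, and $\jmath_X(\alpha):=(\omega_X(\alpha))^\perp$. $(0,\omega)$ is dualizing in $\int Q$ if each canonical arrow $j_X:(X,\alpha)\to(X^{**},\omega_{X^*}(\omega_X(\alpha)))$ is invertible in $\int Q$, where $j_X:X\to X^{**}$ is the transpose of $\mathrm{ev}_{X,0}\circ\sigma_{X^*,X}$. -}

module Defs where

open import Level using (Level; _⊔_) renaming (suc to lsuc)
open import Relation.Binary.PropositionalEquality using (_≡_)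
open import Relation.Binary.Bundles using (Poset)
open import Relation.Unary using (Pred)
open import Data.Product using (Σ; ∃; _×_; _,_)
open import Function.Bundles using (_⇔_)

record CompleteLattice (ℓ : Level) : Set (lsuc ℓ) where
  field
    poset : Poset ℓ ℓ ℓ
  open Poset poset public
  field
    ⋁       : Pred Carrier ℓ → Carrier
    ⋁-upper : (S : Pred Carrier ℓ) {x : Carrier} → S x → x ≤ ⋁ S
    ⋁-least : (S : Pred Carrier ℓ) {y : Carrier} →
              (∀ {x} → S x → x ≤ y) → ⋁ S ≤ y

open CompleteLattice using (Carrier)

Image : ∀ {ℓ} (L M : CompleteLattice ℓ) →
        (CompleteLattice.Carrier L → CompleteLattice.Carrier M) →
        Pred (CompleteLattice.Carrier L) ℓ → Pred (CompleteLattice.Carrier M) ℓ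
Image L M f S y = ∃ λ x → S x × CompleteLattice._≈_ M y (f x)

record IsSupMap {ℓ} (L M : CompleteLattice ℓ)
                (f : CompleteLattice.Carrier L → CompleteLattice.Carrier M) : Set (lsuc ℓ) where
  field
    cong     : ∀ {x y} → CompleteLattice._≈_ L x y → CompleteLattice._≈_ M (f x) (f y)
    pres-⋁   : (S : Pred (CompleteLattice.Carrier L) ℓ) →
               CompleteLattice._≈_ M (f (CompleteLattice.⋁ L S))
                                     (CompleteLattice.⋁ M (Image L M f S))

record Category (o h : Level) : Set (lsuc (o ⊔ h)) where
  infixr 9 _∘_
  field
    Obj  : Set o
    Hom  : Obj → Obj → Set h
    id   : ∀ {A} → Hom A A
    _∘_  : ∀ {A B C} → Hom B C → Hom A B → Hom A C
    identityˡ : ∀ {A B} {f : Hom A B} → id ∘ f ≡ f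
    identityʳ : ∀ {A B} {f : Hom A B} → f ∘ id ≡ f
    assoc     : ∀ {A B C D} {f : Hom A B} {g : Hom B C} {h : Hom C D} →
                (h ∘ g) ∘ f ≡ h ∘ (g ∘ f)

  IsIso : ∀ {A B} → Hom A B → Set h
  IsIso {A} {B} f = Σ (Hom B A) λ g → (g ∘ f ≡ id) × (f ∘ g ≡ id)

record SymmetricMonoidalClosed (o h : Level) : Set (lsuc (o ⊔ h)) where
  field
    category : Category o h
  open Category category public
  infixr 10 _⊗₀_ _⊗₁_
  infixr 5 _⊸_
  field
    _⊗₀_ : Obj → Obj → Obj
    _⊗₁_ : ∀ {A B C D} → Hom A B → Hom C D → Hom (A ⊗₀ C) (B ⊗₀ D)
    ⊗-id : ∀ {A B} → (id {A}) ⊗₁ (id {B}) ≡ id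
    ⊗-∘  : ∀ {A B C A' B' C'} {f : Hom A B} {g : Hom B C} {f' : Hom A' B'} {g' : Hom B' C'} →
           (g ∘ f) ⊗₁ (g' ∘ f') ≡ (g ⊗₁ g') ∘ (f ⊗₁ f')
    I    : Obj
    α⇒   : ∀ {X Y Z} → Hom ((X ⊗₀ Y) ⊗₀ Z) (X ⊗₀ (Y ⊗₀ Z))
    α⇐   : ∀ {X Y Z} → Hom (X ⊗₀ (Y ⊗₀ Z)) ((X ⊗₀ Y) ⊗₀ Z)
    λ⇒   : ∀ {X} → Hom (I ⊗₀ X) X
    λ⇐   : ∀ {X} → Hom X (I ⊗₀ X)
    ρ⇒   : ∀ {X} → Hom (X ⊗₀ I) X
    ρ⇐   : ∀ {X} → Hom X (X ⊗₀ I)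
    σ    : ∀ {X Y} → Hom (X ⊗₀ Y) (Y ⊗₀ X)
    α-isoˡ : ∀ {X Y Z} → α⇐ {X} {Y} {Z} ∘ α⇒ ≡ id
    α-isoʳ : ∀ {X Y Z} → α⇒ {X} {Y} {Z} ∘ α⇐ ≡ id
    λ-isoˡ : ∀ {X} → λ⇐ {X} ∘ λ⇒ ≡ id
    λ-isoʳ : ∀ {X} → λ⇒ {X} ∘ λ⇐ ≡ id
    ρ-isoˡ : ∀ {X} → ρ⇐ {X} ∘ ρ⇒ ≡ id
    ρ-isoʳ : ∀ {X} → ρ⇒ {X} ∘ ρ⇐ ≡ id
    σ-inv  : ∀ {X Y} → σ {Y} {X} ∘ σ {X} {Y} ≡ id
    α-nat  : ∀ {X X' Y Y' Z Z'} {f : Hom X X'} {g : Hom Y Y'} {k : Hom Z Z'} →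
             α⇒ ∘ ((f ⊗₁ g) ⊗₁ k) ≡ (f ⊗₁ (g ⊗₁ k)) ∘ α⇒
    λ-nat  : ∀ {X Y} {f : Hom X Y} → λ⇒ ∘ (id ⊗₁ f) ≡ f ∘ λ⇒
    ρ-nat  : ∀ {X Y} {f : Hom X Y} → ρ⇒ ∘ (f ⊗₁ id) ≡ f ∘ ρ⇒
    σ-nat  : ∀ {X X' Y Y'} {f : Hom X X'} {g : Hom Y Y'} →
             σ ∘ (f ⊗₁ g) ≡ (g ⊗₁ f) ∘ σ
    pentagon : ∀ {W X Y Z} →
               α⇒ {W} {X} {Y ⊗₀ Z} ∘ α⇒ {W ⊗₀ X} {Y} {Z}
                 ≡ (id ⊗₁ α⇒) ∘ (α⇒ ∘ (α⇒ ⊗₁ id))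
    triangle : ∀ {X Y} → (id {X} ⊗₁ λ⇒ {Y}) ∘ α⇒ ≡ ρ⇒ ⊗₁ id
    hexagon  : ∀ {X Y Z} →
               α⇒ {Y} {Z} {X} ∘ (σ {X} {Y ⊗₀ Z} ∘ α⇒ {X} {Y} {Z})
                 ≡ (id ⊗₁ σ) ∘ (α⇒ ∘ (σ ⊗₁ id))
    _⊸_   : Obj → Obj → Obj
    ev    : ∀ {X Y} → Hom (X ⊗₀ (X ⊸ Y)) Y
    curry : ∀ {X Y Z} → Hom (X ⊗₀ Z) Y → Hom Z (X ⊸ Y)
    ev-curry     : ∀ {X Y Z} {f : Hom (X ⊗₀ Z) Y} → ev ∘ (id ⊗₁ curry f) ≡ f
    curry-unique : ∀ {X Y Z} {f : Hom (X ⊗₀ Z) Y} {g : Hom Z (X ⊸ Y)} →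
                   ev ∘ (id ⊗₁ g) ≡ f → g ≡ curry f

module _ {o h} (C : SymmetricMonoidalClosed o h) where
  open SymmetricMonoidalClosed C

  dual : Obj → Obj → Obj
  dual 𝟘 X = X ⊸ 𝟘

  jmap : (𝟘 X : Obj) → Hom X (dual 𝟘 (dual 𝟘 X))
  jmap 𝟘 X = curry {dual 𝟘 X} (ev {X} {𝟘} ∘ σ {dual 𝟘 X} {X})

  IsDualizing : Obj → Set (o ⊔ h)
  IsDualizing 𝟘 = ∀ X → IsIso (jmap 𝟘 X)

record MonoidalFunctor {o h} (C : SymmetricMonoidalClosed o h) (ℓ : Level)
       : Set (o ⊔ h ⊔ lsuc ℓ) where
  open SymmetricMonoidalClosed C
  field
    Q₀ : Obj → CompleteLattice ℓ
  private
    ∣_∣ : Obj → Set ℓ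
    ∣ X ∣ = Carrier (Q₀ X)
    _≈[_]_ : ∀ {X} → ∣ X ∣ → (Y : Obj) → ∣ X ∣ → Set ℓ
    _≈[_]_ {X} a _ b = CompleteLattice._≈_ (Q₀ X) a b
  field
    Q₁     : ∀ {X Y} → Hom X Y → ∣ X ∣ → ∣ Y ∣
    Q₁-sup : ∀ {X Y} (f : Hom X Y) → IsSupMap (Q₀ X) (Q₀ Y) (Q₁ f)
    Q-id   : ∀ {X} (x : ∣ X ∣) → CompleteLattice._≈_ (Q₀ X) (Q₁ id x) x
    Q-∘    : ∀ {X Y Z} (f : Hom X Y) (g : Hom Y Z) (x : ∣ X ∣) →
             CompleteLattice._≈_ (Q₀ Z) (Q₁ (g ∘ f) x) (Q₁ g (Q₁ f x))
    u      : ∣ I ∣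
    μ      : ∀ {X Y} → ∣ X ∣ → ∣ Y ∣ → ∣ X ⊗₀ Y ∣
    μ-supˡ : ∀ {X Y} (y : ∣ Y ∣) → IsSupMap (Q₀ X) (Q₀ (X ⊗₀ Y)) (λ x → μ x y)
    μ-supʳ : ∀ {X Y} (x : ∣ X ∣) → IsSupMap (Q₀ Y) (Q₀ (X ⊗₀ Y)) (λ y → μ x y)
    μ-nat  : ∀ {X X' Y Y'} (f : Hom X X') (g : Hom Y Y') (x : ∣ X ∣) (y : ∣ Y ∣) →
             CompleteLattice._≈_ (Q₀ (X' ⊗₀ Y')) (Q₁ (f ⊗₁ g) (μ x y)) (μ (Q₁ f x) (Q₁ g y))
    μ-λ    : ∀ {Y} (y : ∣ Y ∣) → CompleteLattice._≈_ (Q₀ Y) (Q₁ λ⇒ (μ u y)) y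
    μ-ρ    : ∀ {X} (x : ∣ X ∣) → CompleteLattice._≈_ (Q₀ X) (Q₁ ρ⇒ (μ x u)) x
    μ-α    : ∀ {X Y Z} (x : ∣ X ∣) (y : ∣ Y ∣) (z : ∣ Z ∣) →
             CompleteLattice._≈_ (Q₀ (X ⊗₀ (Y ⊗₀ Z))) (Q₁ α⇒ (μ (μ x y) z)) (μ x (μ y z))
    μ-σ    : ∀ {X Y} (x : ∣ X ∣) (y : ∣ Y ∣) →
             CompleteLattice._≈_ (Q₀ (Y ⊗₀ X)) (Q₁ σ (μ x y)) (μ y x)

module _ {o h ℓ} {C : SymmetricMonoidalClosed o h} (Q : MonoidalFunctor C ℓ) where
  open SymmetricMonoidalClosed C
  open MonoidalFunctor Q

  Q∣_∣ : Obj → Set ℓ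
  Q∣ X ∣ = Carrier (Q₀ X)

  pair : ∀ {X Y} → Q∣ X ∣ → Q∣ X ⊸ Y ∣ → Q∣ Y ∣
  pair {X} {Y} x b = Q₁ (ev {X} {Y}) (μ x b)

  -- ι_{X,Y}(α,-) : the right adjoint of ⟨α,-⟩_{X,Y}
  -- (for a sup-preserving map between complete lattices it is c ↦ ⋁{β | ⟨α,β⟩ ≤ c})
  ι : ∀ {X Y} → Q∣ X ∣ → Q∣ Y ∣ → Q∣ X ⊸ Y ∣
  ι {X} {Y} α c = CompleteLattice.⋁ (Q₀ (X ⊸ Y))
                    (λ β → CompleteLattice._≤_ (Q₀ Y) (pair α β) c)

  module _ (𝟘 : Obj) (ω : Q∣ 𝟘 ∣) where

    ωmap : (X : Obj) → Q∣ X ∣ → Q∣ dual C 𝟘 X ∣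
    ωmap X α = ι {X} {𝟘} α ω

    perp : (X : Obj) → Q∣ dual C 𝟘 X ∣ → Q∣ X ∣
    perp X β = CompleteLattice.⋁ (Q₀ X)
                 (λ α → CompleteLattice._≤_ (Q₀ 𝟘) (pair {X} {𝟘} α β) ω)

    jcl : (X : Obj) → Q∣ X ∣ → Q∣ X ∣
    jcl X α = perp X (ωmap X α)

    -- (0,ω) is dualizing in ∫Q: for every object (X,α) of ∫Q, j_X is an arrow
    -- (X,α) → (X**, ω_{X*}(ω_X(α))) of ∫Q, and it is invertible in ∫Q, i.e. it has an
    -- inverse g in C which is itself an arrow (X**, ω_{X*}(ω_X(α))) → (X,α) of ∫Q.
    IntDualizing : Set (o ⊔ h ⊔ ℓ)
    IntDualizing =
      (X : Obj) (α : Q∣ X ∣) →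
      let t = ωmap (dual C 𝟘 X) (ωmap X α)
          j = jmap C 𝟘 X
      in Σ (CompleteLattice._≤_ (Q₀ (dual C 𝟘 (dual C 𝟘 X))) (Q₁ j α) t) λ _ →
         Σ (Hom (dual C 𝟘 (dual C 𝟘 X)) X) λ g →
           CompleteLattice._≤_ (Q₀ X) (Q₁ g t) α × (g ∘ j ≡ id) × (j ∘ g ≡ id)

{-# OPTIONS --safe #-}
module Submission where

-- The pairing ⟨−,−⟩ makes ω_X and (−)^⊥ the two halves of a Galois connection between
-- Q(X) and Q(X*), so α ≤ ȷ_X α always.  Since ⟨β, Q(j_X) α⟩ = ⟨α, β⟩, the map j_X is
-- an arrow of ∫Q from both (X, α) and (X, ȷ_X α) to (X**, ω_{X*}(ω_X α)).  Hence, if g is an inverse of j_X in C,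
-- Q(g)(ω_{X*}(ω_X α)) is exactly ȷ_X α, and g is an arrow of ∫Q iff ȷ_X α ≤ α.

open import Defs
open import Data.Product using (_×_; _,_)
open import Data.Unit.Polymorphic using (⊤)
open import Function.Bundles using (_⇔_; mk⇔)
open import Relation.Binary.PropositionalEquality using (_≡_; cong)
import Relation.Binary.Reasoning.PartialOrder as PosetReasoning
open import Relation.Unary using (Pred)

module _ {ℓ} (L : CompleteLattice ℓ) where
  open CompleteLattice L

  ⋁-downset : (y : Carrier) → ⋁ (_≤ y) ≈ y
  ⋁-downset y = antisym (⋁-least (_≤ y) (λ x≤y → x≤y)) (⋁-upper (_≤ y) refl)

module SupMap {ℓ} {L M : CompleteLattice ℓ} {f} (f-sup : IsSupMap L M f) where
  private
    module L = CompleteLattice L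
    module M = CompleteLattice M
  open PosetReasoning M.poset

  ⋁-least-image : (S : Pred L.Carrier ℓ) {c : M.Carrier} →
                  (∀ {x} → S x → f x M.≤ c) → f (L.⋁ S) M.≤ c
  ⋁-least-image S {c} fS≤c = begin
    f (L.⋁ S)              ≈⟨ IsSupMap.pres-⋁ f-sup S ⟩
    M.⋁ (Image L M f S)    ≤⟨ M.⋁-least _ (λ { (x , Sx , y≈fx) → M.trans (M.reflexive y≈fx) (fS≤c Sx) }) ⟩
    c                      ∎

  monotone : ∀ {x y} → x L.≤ y → f x M.≤ f y
  monotone {x} {y} x≤y = begin
    f x                        ≤⟨ M.⋁-upper _ (x , x≤y , M.Eq.refl) ⟩
    M.⋁ (Image L M f (L._≤ y)) ≈⟨ IsSupMap.pres-⋁ f-sup _ ⟨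
    f (L.⋁ (L._≤ y))           ≈⟨ IsSupMap.cong f-sup (⋁-downset L y) ⟩
    f y                        ∎

⋁-least-∘ : ∀ {ℓ} {L M N : CompleteLattice ℓ} {f g} →
            IsSupMap L M f → IsSupMap M N g → (S : Pred (CompleteLattice.Carrier L) ℓ) →
            {c : CompleteLattice.Carrier N} →
            (∀ {x} → S x → CompleteLattice._≤_ N (g (f x)) c) →
            CompleteLattice._≤_ N (g (f (CompleteLattice.⋁ L S))) c
⋁-least-∘ {N = N} f-sup g-sup S gfS≤c =
  N.trans (N.reflexive (IsSupMap.cong g-sup (IsSupMap.pres-⋁ f-sup S)))
          (SupMap.⋁-least-image g-sup _ λ { (x , Sx , y≈fx) →
             N.trans (N.reflexive (IsSupMap.cong g-sup y≈fx)) (gfS≤c Sx) })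
  where module N = CompleteLattice N

module Pairing {o h ℓ} {C : SymmetricMonoidalClosed o h} (Q : MonoidalFunctor C ℓ) where
  open SymmetricMonoidalClosed C
  open MonoidalFunctor Q
  module L (X : Obj) = CompleteLattice (Q₀ X)

  Le : (X : Obj) → Q∣ Q ∣ X → Q∣ Q ∣ X → Set ℓ
  Le X = L._≤_ X
  syntax Le X a b = a ≤[ X ] b

  Equal : (X : Obj) → Q∣ Q ∣ X → Q∣ Q ∣ X → Set ℓ
  Equal X = L._≈_ X
  syntax Equal X a b = a ≈[ X ] b

  Q₁-section : ∀ {X Y} {f : Hom X Y} {g : Hom Y X} → g ∘ f ≡ id →
               (x : Q∣ Q ∣ X) → Q₁ g (Q₁ f x) ≈[ X ] x
  Q₁-section {X} {f = f} {g} g∘f≡id x = begin-equality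
    Q₁ g (Q₁ f x)  ≈⟨ Q-∘ f g x ⟨
    Q₁ (g ∘ f) x   ≡⟨ cong (λ k → Q₁ k x) g∘f≡id ⟩
    Q₁ id x        ≈⟨ Q-id x ⟩
    x              ∎
    where open PosetReasoning (L.poset X)

  ι-counit : ∀ {X Y} (α : Q∣ Q ∣ X) (c : Q∣ Q ∣ Y) → pair Q α (ι Q α c) ≤[ Y ] c
  ι-counit α c = ⋁-least-∘ (μ-supʳ α) (Q₁-sup ev) _ (λ pairαβ≤c → pairαβ≤c)

module Bidual {o h ℓ} {C : SymmetricMonoidalClosed o h} (Q : MonoidalFunctor C ℓ)
              (𝟘 : SymmetricMonoidalClosed.Obj C) (ω : Q∣ Q ∣ 𝟘) where
  open SymmetricMonoidalClosed C
  open MonoidalFunctor Q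
  open Pairing Q

  ωbidual : (X : Obj) → Q∣ Q ∣ X → Q∣ Q ∣ (dual C 𝟘 (dual C 𝟘 X))
  ωbidual X α = ωmap Q 𝟘 ω (dual C 𝟘 X) (ωmap Q 𝟘 ω X α)

  perp-counit : ∀ {X} (β : Q∣ Q ∣ (dual C 𝟘 X)) → pair Q (perp Q 𝟘 ω X β) β ≤[ 𝟘 ] ω
  perp-counit β = ⋁-least-∘ (μ-supˡ β) (Q₁-sup ev) _ (λ pairαβ≤ω → pairαβ≤ω)

  pair-jmap : ∀ {X} (α : Q∣ Q ∣ X) (β : Q∣ Q ∣ (dual C 𝟘 X)) →
              pair Q β (Q₁ (jmap C 𝟘 X) α) ≈[ 𝟘 ] pair Q α β
  pair-jmap {X} α β = begin-equality
    Q₁ ev (μ β (Q₁ j α))           ≈⟨ IsSupMap.cong (Q₁-sup ev) (IsSupMap.cong (μ-supˡ (Q₁ j α)) (Q-id β)) ⟨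
    Q₁ ev (μ (Q₁ id β) (Q₁ j α))   ≈⟨ IsSupMap.cong (Q₁-sup ev) (μ-nat id j β α) ⟨
    Q₁ ev (Q₁ (id ⊗₁ j) (μ β α))   ≈⟨ Q-∘ (id ⊗₁ j) ev (μ β α) ⟨
    Q₁ (ev ∘ (id ⊗₁ j)) (μ β α)    ≡⟨ cong (λ k → Q₁ k (μ β α)) ev-curry ⟩
    Q₁ (ev ∘ σ) (μ β α)            ≈⟨ Q-∘ σ ev (μ β α) ⟩
    Q₁ ev (Q₁ σ (μ β α))           ≈⟨ IsSupMap.cong (Q₁-sup ev) (μ-σ β α) ⟩
    Q₁ ev (μ α β)                  ∎
    where
    j = jmap C 𝟘 X
    open PosetReasoning (L.poset 𝟘)

  jmap-≤-ωmap : ∀ {X} {α : Q∣ Q ∣ X} {β : Q∣ Q ∣ (dual C 𝟘 X)} → pair Q α β ≤[ 𝟘 ] ω →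
                Q₁ (jmap C 𝟘 X) α ≤[ dual C 𝟘 (dual C 𝟘 X) ] ωmap Q 𝟘 ω (dual C 𝟘 X) β
  jmap-≤-ωmap {X} {α} {β} pairαβ≤ω =
    L.⋁-upper (dual C 𝟘 (dual C 𝟘 X)) _ (L.trans 𝟘 (L.reflexive 𝟘 (pair-jmap α β)) pairαβ≤ω)

  jmap-≤-ωbidual : ∀ X (α : Q∣ Q ∣ X) → Q₁ (jmap C 𝟘 X) α ≤[ dual C 𝟘 (dual C 𝟘 X) ] ωbidual X α
  jmap-≤-ωbidual X α = jmap-≤-ωmap (ι-counit α ω)

  ≤-jcl : ∀ X (α : Q∣ Q ∣ X) → α ≤[ X ] jcl Q 𝟘 ω X α
  ≤-jcl X α = L.⋁-upper X _ (ι-counit α ω)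

  jcl-≤-retraction : ∀ {X} {α : Q∣ Q ∣ X} {g : Hom (dual C 𝟘 (dual C 𝟘 X)) X} →
                     g ∘ jmap C 𝟘 X ≡ id → jcl Q 𝟘 ω X α ≤[ X ] Q₁ g (ωbidual X α)
  jcl-≤-retraction {X} {α} {g} g∘j≡id = begin
    jcl Q 𝟘 ω X α                          ≈⟨ Q₁-section g∘j≡id _ ⟨
    Q₁ g (Q₁ (jmap C 𝟘 X) (jcl Q 𝟘 ω X α)) ≤⟨ SupMap.monotone (Q₁-sup g) (jmap-≤-ωmap (perp-counit _)) ⟩
    Q₁ g (ωbidual X α)                     ∎
    where open PosetReasoning (L.poset X)

  section-≤-jcl : ∀ {X} {α : Q∣ Q ∣ X} {g : Hom (dual C 𝟘 (dual C 𝟘 X)) X} →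
                  jmap C 𝟘 X ∘ g ≡ id → Q₁ g (ωbidual X α) ≤[ X ] jcl Q 𝟘 ω X α
  section-≤-jcl {X} {α} {g} j∘g≡id = L.⋁-upper X _ (begin
    pair Q (Q₁ g t) ωα                   ≈⟨ pair-jmap (Q₁ g t) ωα ⟨
    pair Q ωα (Q₁ (jmap C 𝟘 X) (Q₁ g t)) ≈⟨ IsSupMap.cong (Q₁-sup ev) (IsSupMap.cong (μ-supʳ ωα) (Q₁-section j∘g≡id t)) ⟩
    pair Q ωα t                          ≤⟨ ι-counit ωα ω ⟩
    ω                                    ∎)
    where
    ωα = ωmap Q 𝟘 ω X α
    t = ωbidual X α
    open PosetReasoning (L.poset 𝟘)

  inverse-ωbidual≈jcl : ∀ {X} {α : Q∣ Q ∣ X} {g : Hom (dual C 𝟘 (dual C 𝟘 X)) X} →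
                        g ∘ jmap C 𝟘 X ≡ id → jmap C 𝟘 X ∘ g ≡ id →
                        Q₁ g (ωbidual X α) ≈[ X ] jcl Q 𝟘 ω X α
  inverse-ωbidual≈jcl {X} g∘j≡id j∘g≡id = L.antisym X (section-≤-jcl j∘g≡id) (jcl-≤-retraction g∘j≡id)

mainTheorem12 : ∀ {o h ℓ} (C : SymmetricMonoidalClosed o h)
                  (𝟘 : SymmetricMonoidalClosed.Obj C) → IsDualizing C 𝟘 →
                  (Q : MonoidalFunctor C ℓ) (ω : Q∣_∣ Q 𝟘) →
                  IntDualizing Q 𝟘 ω
                    ⇔ (IsDualizing C 𝟘 ×
                       ((X : SymmetricMonoidalClosed.Obj C) (α : Q∣_∣ Q X) →
                          CompleteLattice._≈_ (MonoidalFunctor.Q₀ Q X) (jcl Q 𝟘 ω X α) α))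
mainTheorem12 C 𝟘 _ Q ω = mk⇔ forward backward
  where
  open SymmetricMonoidalClosed C
  open MonoidalFunctor Q
  open Pairing Q
  open Bidual Q 𝟘 ω

  forward : IntDualizing Q 𝟘 ω →
            IsDualizing C 𝟘 × ((X : Obj) (α : Q∣ Q ∣ X) → jcl Q 𝟘 ω X α ≈[ X ] α)
  forward int-dualizing = dualizing , jcl-identity
    where
    dualizing : IsDualizing C 𝟘
    dualizing X with int-dualizing X (L.⋁ X (λ _ → ⊤))
    ... | _ , g , _ , g∘j≡id , j∘g≡id = g , g∘j≡id , j∘g≡id

    jcl-identity : (X : Obj) (α : Q∣ Q ∣ X) → jcl Q 𝟘 ω X α ≈[ X ] α
    jcl-identity X α with int-dualizing X α
    ... | _ , g , gt≤α , g∘j≡id , j∘g≡id =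
      L.antisym X (L.trans X (L.reflexive X (L.Eq.sym X (inverse-ωbidual≈jcl g∘j≡id j∘g≡id))) gt≤α)
                  (≤-jcl X α)

  backward : IsDualizing C 𝟘 × ((X : Obj) (α : Q∣ Q ∣ X) → jcl Q 𝟘 ω X α ≈[ X ] α) →
             IntDualizing Q 𝟘 ω
  backward (dualizing , jcl-identity) X α with dualizing X
  ... | g , g∘j≡id , j∘g≡id =
    jmap-≤-ωbidual X α , g ,
    L.reflexive X (L.Eq.trans X (inverse-ωbidual≈jcl g∘j≡id j∘g≡id) (jcl-identity X α)) ,
    g∘j≡id , j∘g≡id
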